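{- Let $\mathbb{K}$ be a field of characteristic $0$, let $n$ be a positive integer and $x(k)\in\mathbb{K}[k]$ any polynomial. Then $$\sum_{k=0}^{n-1}\Big[(k+1)^3x(k)-(2k+1)(17k^2+17k+5)x(k-1)+k^3x(k-2)\Big]A_k=n^3\big(x(n-1)A_{n-1}-x(n-2)A_n\big).$$
   Context: $A_n=\sum_{k=0}^{n}\binom{n}{k}^2\binom{n+k}{k}^2$ are the Apéry numbers. (The bracketed polynomial is $L^{\ast}(x(k))=\sum_{i=0}^2 a_i(k-i)x(k-i)$ for the annihilating operator $L=a_2(k)\sigma^2+a_1(k)\sigma+a_0(k)$ of $A_k$ with $a_2(k)=(k+2)^3$, $a_1(k)=-(2k+3)(17k^2+51k+39)$, $a_0(k)=(k+1)^3$, where $\sigma$ is the shift $k\mapsto k+1$.) -}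

module Defs where

open import Level using (_⊔_) renaming (suc to lsuc)
open import Data.Nat as ℕ using (ℕ; zero; suc)
open import Data.Nat.Combinatorics using (_C_)
open import Data.Integer as ℤ using (ℤ; +_; -[1+_])
open import Data.List using (List; []; _∷_)
open import Data.Product using (∃)
open import Relation.Nullary using (¬_)
open import Relation.Binary.PropositionalEquality using (_≡_)
open import Algebra.Bundles using (CommutativeRing)

record Field c ℓ : Set (lsuc (c ⊔ ℓ)) where
  field
    commutativeRing : CommutativeRing c ℓ
  open CommutativeRing commutativeRing public
  field
    0≉1     : ¬ (0# ≈ 1#)
    inverse : ∀ x → ¬ (x ≈ 0#) → ∃ λ y → (x * y) ≈ 1#

module _ {c ℓ} (F : Field c ℓ) where
  open Field F

  ιℕ : ℕ → Carrier
  ιℕ zero    = 0#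
  ιℕ (suc n) = 1# + ιℕ n

  ιℤ : ℤ → Carrier
  ιℤ (+ n)      = ιℕ n
  ιℤ -[1+ n ]   = - ιℕ (suc n)

  CharZero : Set ℓ
  CharZero = ∀ n → ιℕ n ≈ 0# → n ≡ 0

  -- polynomials in F[k], as coefficient lists [c₀, c₁, …] (lowest degree first)
  Poly : Set c
  Poly = List Carrier

  eval : Poly → Carrier → Carrier
  eval []       t = 0#
  eval (a ∷ as) t = a + t * eval as t

  sumF : ℕ → (ℕ → Carrier) → Carrier
  sumF zero    f = 0#
  sumF (suc n) f = sumF n f + f n

sumℕ : ℕ → (ℕ → ℕ) → ℕ
sumℕ zero    f = 0
sumℕ (suc n) f = sumℕ n f ℕ.+ f n

-- Apéry numbers  A_n = Σ_{k=0}^{n} C(n,k)² C(n+k,k)²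
apery : ℕ → ℕ
apery n = sumℕ (suc n) λ k → (n C k) ℕ.^ 2 ℕ.* ((n ℕ.+ k) C k) ℕ.^ 2

-- Zeilberger's algorithm, applied to F(n,k) = C(n,k)² C(n+k,k)², yields a polynomial certificate G with
--   (n+1)³ F(n+1,k) − (2n+1)(17n²+17n+5) F(n,k) + n³ F(n−1,k) = G(n,k+1) − G(n,k);
-- summing over k gives Apéry's recurrence over ℤ, which the canonical map ℤ → 𝕂 carries into the field.
-- The bracket in the theorem is the adjoint of this recurrence operator, so by Lagrange's identity
-- each term of the sum is g(k+1) − g(k) with g(k) = k³ (x(k−1) A_{k−1} − x(k−2) A_k), and the sum telescopes.
module Submission where

open import Defs
open import Data.Nat as ℕ using (ℕ; _≤_)
open import Data.Integer as ℤ using (ℤ; +_)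

module ApéryBinomial where

  open import Data.Nat
  open import Data.Nat.Properties
  open import Data.Nat.Combinatorics using (_C_; nCk≡n!/k![n-k]!; k![n∸k]!∣n!; k>n⇒nCk≡0)
  open import Data.Nat.DivMod using (m/n*n≡m)
  open import Data.Nat.Tactic.RingSolver using (solve-∀)
  open import Relation.Binary.PropositionalEquality
  open ≡-Reasoning

  C*factorials : ∀ k m → ((k + m) C k) * (k ! * m !) ≡ (k + m) !
  C*factorials k m = begin
    ((k + m) C k) * (k ! * m !)
      ≡⟨ cong (λ t → ((k + m) C k) * (k ! * t !)) (sym (m+n∸m≡n k m)) ⟩
    ((k + m) C k) * (k ! * (k + m ∸ k) !)
      ≡⟨ cong (_* (k ! * (k + m ∸ k) !)) (nCk≡n!/k![n-k]! k≤k+m) ⟩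
    (k + m) ! / (k ! * (k + m ∸ k) !) * (k ! * (k + m ∸ k) !)
      ≡⟨ m/n*n≡m (k![n∸k]!∣n! k≤k+m) ⟩
    (k + m) ! ∎
    where
    k≤k+m = m≤m+n k m
    instance _ = k !* (k + m ∸ k) !≢0

  aperyBinomial : ℕ → ℕ → ℕ
  aperyBinomial n k = (n C k) * ((n + k) C k)

  aperySummand : ℕ → ℕ → ℕ
  aperySummand n k = (n C k) ^ 2 * ((n + k) C k) ^ 2

  aperySummand-square : ∀ n k → aperySummand n k ≡ aperyBinomial n k * aperyBinomial n k
  aperySummand-square n k = regroup (n C k) ((n + k) C k)
    where
    regroup : ∀ x y → x * (x * 1) * (y * (y * 1)) ≡ x * y * (x * y)
    regroup = solve-∀

  aperyBinomial-vanish : ∀ {n k} → n < k → aperyBinomial n k ≡ 0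
  aperyBinomial-vanish n<k rewrite k>n⇒nCk≡0 n<k = refl

  aperySummand-vanish : ∀ {n k} → n < k → aperySummand n k ≡ 0
  aperySummand-vanish n<k rewrite k>n⇒nCk≡0 n<k = refl

  aperyBinomial-factorials : ∀ b r → aperyBinomial (b + r) b * (b ! * b ! * r !) ≡ (b + r + b) !
  aperyBinomial-factorials b r = *-cancelʳ-≡ _ _ ((b + r) !) {{(b + r) !≢0}} (begin
    ((b + r) C b) * ((b + r + b) C b) * (b ! * b ! * r !) * (b + r) !
      ≡⟨ regroup ((b + r) C b) ((b + r + b) C b) (b !) (r !) ((b + r) !) ⟩
    (((b + r) C b) * (b ! * r !)) * (((b + r + b) C b) * (b ! * (b + r) !))
      ≡⟨ cong₂ _*_ (C*factorials b r) second ⟩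
    (b + r) ! * (b + r + b) !
      ≡⟨ *-comm ((b + r) !) _ ⟩
    (b + r + b) ! * (b + r) ! ∎)
    where
    regroup : ∀ c c′ x y z → c * c′ * (x * x * y) * z ≡ (c * (x * y)) * (c′ * (x * z))
    regroup = solve-∀
    second : ((b + r + b) C b) * (b ! * (b + r) !) ≡ (b + r + b) !
    second = subst (λ t → (t C b) * (b ! * (b + r) !) ≡ t !) (+-comm b (b + r)) (C*factorials b (b + r))

  -- With n = k + r, each value of aperyBinomial met by the certificate below is
  -- (n+k)! / ((k+1)!² r!) times a polynomial in k and r.

  ratio-[n,k] : ∀ k r → suc k ! * suc k ! * r ! * aperyBinomial (k + r) k
                        ≡ (k + r + k) ! * ((k + 1) * (k + 1))
  ratio-[n,k] k r = begin
    suc k ! * suc k ! * r ! * aperyBinomial (k + r) k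
      ≡⟨ regroup k (k !) (r !) (aperyBinomial (k + r) k) ⟩
    aperyBinomial (k + r) k * (k ! * k ! * r !) * ((k + 1) * (k + 1))
      ≡⟨ cong (_* ((k + 1) * (k + 1))) (aperyBinomial-factorials k r) ⟩
    (k + r + k) ! * ((k + 1) * (k + 1)) ∎
    where
    regroup : ∀ k x y c → (1 + k) * x * ((1 + k) * x) * y * c ≡ c * (x * x * y) * ((k + 1) * (k + 1))
    regroup = solve-∀

  ratio-[n+1,k+1] : ∀ k r → suc k ! * suc k ! * r ! * aperyBinomial (suc (k + r)) (suc k)
                            ≡ (k + r + k) ! * ((k + r + k + 1) * (k + r + k + 2))
  ratio-[n+1,k+1] k r = begin
    suc k ! * suc k ! * r ! * aperyBinomial (suc (k + r)) (suc k)
      ≡⟨ *-comm (suc k ! * suc k ! * r !) _ ⟩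
    aperyBinomial (suc k + r) (suc k) * (suc k ! * suc k ! * r !)
      ≡⟨ aperyBinomial-factorials (suc k) r ⟩
    (suc k + r + suc k) !
      ≡⟨ cong _! (+-suc (suc (k + r)) k) ⟩
    (2 + (k + r + k)) !
      ≡⟨ unfold (k + r + k) ((k + r + k) !) ⟩
    (k + r + k) ! * ((k + r + k + 1) * (k + r + k + 2)) ∎
    where
    unfold : ∀ m f → (2 + m) * ((1 + m) * f) ≡ f * ((m + 1) * (m + 2))
    unfold = solve-∀

  ratio-[n,k+1] : ∀ k r → suc k ! * suc k ! * r ! * aperyBinomial (k + r) (suc k)
                          ≡ (k + r + k) ! * ((k + r + k + 1) * r)
  ratio-[n,k+1] k zero
    rewrite aperyBinomial-vanish (s≤s (≤-reflexive (+-identityʳ k)))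
          | *-zeroʳ (suc k ! * suc k ! * 1) | *-zeroʳ (k + 0 + k + 1) | *-zeroʳ ((k + 0 + k) !) = refl
  ratio-[n,k+1] k (suc q) rewrite +-suc k q = begin
    suc k ! * suc k ! * suc q ! * aperyBinomial (suc (k + q)) (suc k)
      ≡⟨ regroup (suc k !) (q !) q (aperyBinomial (suc (k + q)) (suc k)) ⟩
    aperyBinomial (suc k + q) (suc k) * (suc k ! * suc k ! * q !) * suc q
      ≡⟨ cong (_* suc q) (aperyBinomial-factorials (suc k) q) ⟩
    (suc k + q + suc k) ! * suc q
      ≡⟨ cong (λ t → t ! * suc q) (+-suc (suc (k + q)) k) ⟩
    (2 + (k + q + k)) ! * suc q
      ≡⟨ unfold (suc (k + q + k)) ((suc (k + q + k)) !) q ⟩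
    (suc (k + q + k)) ! * ((suc (k + q + k) + 1) * suc q) ∎
    where
    regroup : ∀ x y q c → x * x * ((1 + q) * y) * c ≡ c * (x * x * y) * (1 + q)
    regroup = solve-∀
    unfold : ∀ m f q → (1 + m) * f * (1 + q) ≡ f * ((m + 1) * (1 + q))
    unfold = solve-∀

  ratio-[n-1,k+1] : ∀ k r → suc k ! * suc k ! * r ! * aperyBinomial (k + r ∸ 1) (suc k)
                            ≡ (k + r + k) ! * (r * (r ∸ 1))
  ratio-[n-1,k+1] k zero
    rewrite aperyBinomial-vanish (s≤s (≤-trans (m∸n≤m (k + 0) 1) (≤-reflexive (+-identityʳ k))))
          | *-zeroʳ (suc k ! * suc k ! * 1) | *-zeroʳ ((k + 0 + k) !) = refl
  ratio-[n-1,k+1] k (suc zero)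
    rewrite aperyBinomial-vanish (s≤s (≤-reflexive (m+n∸n≡m k 1)))
          | *-zeroʳ (suc k ! * suc k ! * 1) | *-zeroʳ ((k + 1 + k) !) = refl
  ratio-[n-1,k+1] k (suc (suc q)) rewrite +-suc k (suc q) | +-suc k q = begin
    suc k ! * suc k ! * suc (suc q) ! * aperyBinomial (suc (k + q)) (suc k)
      ≡⟨ regroup (suc k !) (q !) q (aperyBinomial (suc (k + q)) (suc k)) ⟩
    aperyBinomial (suc k + q) (suc k) * (suc k ! * suc k ! * q !) * (suc (suc q) * suc q)
      ≡⟨ cong (_* (suc (suc q) * suc q)) (aperyBinomial-factorials (suc k) q) ⟩
    (suc k + q + suc k) ! * (suc (suc q) * suc q)
      ≡⟨ cong (λ t → t ! * (suc (suc q) * suc q)) (+-suc (suc (k + q)) k) ⟩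
    (2 + (k + q + k)) ! * (suc (suc q) * suc q) ∎
    where
    regroup : ∀ x y q c → x * x * ((2 + q) * ((1 + q) * y)) * c ≡ c * (x * x * y) * ((2 + q) * (1 + q))
    regroup = solve-∀

module ApéryRecurrence where

  open ApéryBinomial
  open import Data.Nat as ℕ using (ℕ; zero; suc; _≤_; _<_; z≤n; s≤s; _∸_; _!)
  import Data.Nat.Properties as ℕP
  open import Data.Integer using (ℤ; +_; 0ℤ; 1ℤ; _+_; _*_; _-_; _^_; NonZero)
  import Data.Integer.Properties as ℤP
  open import Data.Integer.Tactic.RingSolver using (solve-∀)
  open import Data.Sum using (inj₁; inj₂)
  open import Relation.Binary.PropositionalEquality
  open ≡-Reasoning

  sumℤ : ℕ → (ℕ → ℤ) → ℤ
  sumℤ zero    f = 0ℤ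
  sumℤ (suc n) f = sumℤ n f + f n

  sumℤ-telescope : ∀ {f g : ℕ → ℤ} J → g 0 ≡ 0ℤ → (∀ j → j < J → f j ≡ g (suc j) - g j) →
                   sumℤ J f ≡ g J
  sumℤ-telescope zero    g0≡0 _    = sym g0≡0
  sumℤ-telescope {f} {g} (suc J) g0≡0 step = begin
    sumℤ J f + f J
      ≡⟨ cong₂ _+_ (sumℤ-telescope {g = g} J g0≡0 (λ j j<J → step j (ℕP.m≤n⇒m≤1+n j<J)))
                   (step J ℕP.≤-refl) ⟩
    g J + (g (suc J) - g J)
      ≡⟨ cancel (g J) (g (suc J)) ⟩
    g (suc J) ∎
    where
    cancel : ∀ a b → a + (b - a) ≡ b
    cancel = solve-∀

  sumℕ-vanishing-tail : ∀ {f m J} → (∀ j → m ≤ j → f j ≡ 0) → m ≤ J → sumℕ J f ≡ sumℕ m f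
  sumℕ-vanishing-tail {J = zero}  _      z≤n = refl
  sumℕ-vanishing-tail {J = suc J} vanish m≤1+J with ℕP.m≤n⇒m<n∨m≡n m≤1+J
  ... | inj₁ (s≤s m≤J) =
    trans (cong₂ ℕ._+_ (sumℕ-vanishing-tail vanish m≤J) (vanish J m≤J)) (ℕP.+-identityʳ _)
  ... | inj₂ refl      = refl

  pos-sumℕ : ∀ J f → + sumℕ J f ≡ sumℤ J (λ j → + f j)
  pos-sumℕ zero    f = refl
  pos-sumℕ (suc J) f = trans (ℤP.pos-+ (sumℕ J f) (f J)) (cong (_+ + f J) (pos-sumℕ J f))

  apery≡sumℤ : ∀ {m J} → m < J → + apery m ≡ sumℤ J (λ j → + aperySummand m j)
  apery≡sumℤ {m} {J} m<J = begin
    + sumℕ (suc m) (aperySummand m)    ≡⟨ cong +_ (sym (sumℕ-vanishing-tail (λ _ → aperySummand-vanish) m<J)) ⟩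
    + sumℕ J (aperySummand m)          ≡⟨ pos-sumℕ J (aperySummand m) ⟩
    sumℤ J (λ j → + aperySummand m j)  ∎

  -- The paper's operator L shifted by one: p₊ n = a₂(n−1), p₀ n = −a₁(n−1), p₋ n = a₀(n−1).
  p₊ p₀ p₋ : ℤ → ℤ
  p₊ N = (N + 1ℤ) * (N + 1ℤ) * (N + 1ℤ)
  p₀ N = (+ 2 * N + 1ℤ) * (+ 17 * N * N + + 17 * N + + 5)
  p₋ N = N * N * N

  apéryOp : (ℕ → ℤ) → ℕ → ℤ
  apéryOp u n = p₊ (+ n) * u (suc n) - p₀ (+ n) * u n + p₋ (+ n) * u (n ∸ 1)

  apéryOp-cong : ∀ {u v} n → (∀ m → m ≤ suc n → u m ≡ v m) → apéryOp u n ≡ apéryOp v n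
  apéryOp-cong n eq
    rewrite eq (suc n) ℕP.≤-refl | eq n (ℕP.n≤1+n n) | eq (n ∸ 1) (ℕP.m≤n⇒m≤1+n (ℕP.m∸n≤m n 1)) = refl

  apéryOp-sumℤ : ∀ J (f : ℕ → ℕ → ℤ) n →
    apéryOp (λ m → sumℤ J (f m)) n ≡ sumℤ J (λ j → apéryOp (λ m → f m j) n)
  apéryOp-sumℤ zero    f n = annihilate (p₊ (+ n)) (p₀ (+ n)) (p₋ (+ n))
    where
    annihilate : ∀ a b c → a * 0ℤ - b * 0ℤ + c * 0ℤ ≡ 0ℤ
    annihilate = solve-∀
  apéryOp-sumℤ (suc J) f n = begin
    apéryOp (λ m → sumℤ J (f m) + f m J) n
      ≡⟨ additive (p₊ (+ n)) (p₀ (+ n)) (p₋ (+ n)) _ _ _ _ _ _ ⟩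
    apéryOp (λ m → sumℤ J (f m)) n + apéryOp (λ m → f m J) n
      ≡⟨ cong (_+ apéryOp (λ m → f m J) n) (apéryOp-sumℤ J f n) ⟩
    sumℤ J (λ j → apéryOp (λ m → f m j) n) + apéryOp (λ m → f m J) n ∎
    where
    additive : ∀ a b c x y z x′ y′ z′ →
      a * (x + x′) - b * (y + y′) + c * (z + z′) ≡ (a * x - b * y + c * z) + (a * x′ - b * y′ + c * z′)
    additive = solve-∀

  -- The reflective ring solver reads neither ℤ's _^_ nor user definitions,
  -- so its identities below are stated with everything unfolded.
  apéryOp-powers : ∀ u n → (+ n + + 1) ^ 3 * u (suc n)
                           - (+ 2 * + n + + 1) * (+ 17 * (+ n) ^ 2 + + 17 * + n + + 5) * u n
                           + (+ n) ^ 3 * u (n ∸ 1) ≡ apéryOp u n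
  apéryOp-powers u n = unfold (+ n) (u (suc n)) (u n) (u (n ∸ 1))
    where
    unfold : ∀ N a b c →
      (N + 1ℤ) * ((N + 1ℤ) * ((N + 1ℤ) * 1ℤ)) * a - (+ 2 * N + 1ℤ) * (+ 17 * (N * (N * 1ℤ)) + + 17 * N + + 5) * b
        + N * (N * (N * 1ℤ)) * c
      ≡ (N + 1ℤ) * (N + 1ℤ) * (N + 1ℤ) * a - (+ 2 * N + 1ℤ) * (+ 17 * N * N + + 17 * N + + 5) * b + N * N * N * c
    unfold = solve-∀

  apéryQuadratic : ℤ → ℤ → ℤ → ℤ → ℤ
  apéryQuadratic N x y z = p₊ N * (x * x) - p₀ N * (y * y) + p₋ N * (z * z)

  apéryOp-aperySummand : ∀ n k → apéryOp (λ m → + aperySummand m k) n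
    ≡ apéryQuadratic (+ n) (+ aperyBinomial (suc n) k) (+ aperyBinomial n k) (+ aperyBinomial (n ∸ 1) k)
  apéryOp-aperySummand n k =
    apéryOp-cong n λ m _ →
      trans (cong +_ (aperySummand-square m k)) (ℤP.pos-* (aperyBinomial m k) (aperyBinomial m k))

  apéryQuadratic-rescale : ∀ d N {x y z x′ y′ z′} → d * x ≡ x′ → d * y ≡ y′ → d * z ≡ z′ →
    d * d * apéryQuadratic N x y z ≡ apéryQuadratic N x′ y′ z′
  apéryQuadratic-rescale d N {x} {y} {z} refl refl refl = homogeneous d (p₊ N) (p₀ N) (p₋ N) x y z
    where
    homogeneous : ∀ d a b c x y z → d * d * (a * (x * x) - b * (y * y) + c * (z * z))
                                    ≡ a * (d * x * (d * x)) - b * (d * y * (d * y)) + c * (d * z * (d * z))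
    homogeneous = solve-∀

  -- certificate n k is the G(n,k) of the header.
  certificateWeight : ℤ → ℤ → ℤ
  certificateWeight N K = + 4 * (+ 2 * N + 1ℤ) * (K * (+ 2 * K + 1ℤ) - (+ 2 * N + 1ℤ) * (+ 2 * N + 1ℤ))

  certificate : ℕ → ℕ → ℤ
  certificate n zero    = 0ℤ
  certificate n (suc k) = certificateWeight (+ n) (+ k) * (+ aperyBinomial n k * + aperyBinomial n k)

  certificate-rescale : ∀ d a b {y z y′ z′} → d * y ≡ y′ → d * z ≡ z′ →
    d * d * (a * (y * y) - b * (z * z)) ≡ a * (y′ * y′) - b * (z′ * z′)
  certificate-rescale d a b {y} {z} refl refl = homogeneous d a b y z
    where
    homogeneous : ∀ d a b y z → d * d * (a * (y * y) - b * (z * z))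
                                ≡ a * (d * y * (d * y)) - b * (d * z * (d * z))
    homogeneous = solve-∀

  certificate-identity : ∀ e K R → let N = K + R; M = N + K + 1ℤ; T = + 2 * N + 1ℤ in
      (N + 1ℤ) * (N + 1ℤ) * (N + 1ℤ) * (e * (M * (N + K + + 2)) * (e * (M * (N + K + + 2))))
    - T * (+ 17 * N * N + + 17 * N + + 5) * (e * (M * R) * (e * (M * R)))
    + N * N * N * (e * (R * (R - 1ℤ)) * (e * (R * (R - 1ℤ))))
    ≡ + 4 * T * ((1ℤ + K) * (+ 2 * (1ℤ + K) + 1ℤ) - T * T) * (e * (M * R) * (e * (M * R)))
    - + 4 * T * (K * (+ 2 * K + 1ℤ) - T * T) * (e * ((K + 1ℤ) * (K + 1ℤ)) * (e * ((K + 1ℤ) * (K + 1ℤ))))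
  certificate-identity = solve-∀

  pos-*-≡ : ∀ {D x E p} → D ℕ.* x ≡ E ℕ.* p → + D * + x ≡ + E * + p
  pos-*-≡ {D} {x} {E} {p} eq = trans (sym (ℤP.pos-* D x)) (trans (cong +_ eq) (ℤP.pos-* E p))

  pos-*-pred : ∀ r → + (r ℕ.* (r ∸ 1)) ≡ + r * (+ r - 1ℤ)
  pos-*-pred zero    = refl
  pos-*-pred (suc q) = ℤP.pos-* (suc q) q

  certificate-step : ∀ k r → apéryOp (λ m → + aperySummand m (suc k)) (k ℕ.+ r)
                             ≡ certificate (k ℕ.+ r) (suc (suc k)) - certificate (k ℕ.+ r) (suc k)
  -- Scaled by d², each aperyBinomial becomes e times a polynomial, leaving certificate-identity.
  certificate-step k r = ℤP.*-cancelˡ-≡ (d * d) _ _ {{ℤP.i*j≢0 d d}} (begin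
    d * d * apéryOp (λ m → + aperySummand m (suc k)) n
      ≡⟨ cong (d * d *_) (apéryOp-aperySummand n (suc k)) ⟩
    d * d * apéryQuadratic N (+ aperyBinomial (suc n) (suc k)) (+ aperyBinomial n (suc k))
                             (+ aperyBinomial (n ∸ 1) (suc k))
      ≡⟨ apéryQuadratic-rescale d N ratio-next ratio-here ratio-prev ⟩
    apéryQuadratic N (e * (M * (N + K + + 2))) (e * (M * R)) (e * (R * (R - 1ℤ)))
      ≡⟨ certificate-identity e K R ⟩
    certificateWeight N (1ℤ + K) * (e * (M * R) * (e * (M * R)))
      - certificateWeight N K * (e * ((K + 1ℤ) * (K + 1ℤ)) * (e * ((K + 1ℤ) * (K + 1ℤ))))
      ≡⟨ sym (certificate-rescale d (certificateWeight N (1ℤ + K)) (certificateWeight N K)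
                                  ratio-here ratio-diag) ⟩
    d * d * (certificate n (suc (suc k)) - certificate n (suc k)) ∎)
    where
    n = k ℕ.+ r
    N = + n
    K = + k
    R = + r
    M = N + K + 1ℤ
    D = suc k ! ℕ.* suc k ! ℕ.* r !
    E = (n ℕ.+ k) !
    d = + D
    e = + E
    instance
      d≢0 : NonZero d
      d≢0 = ℕP.m*n≢0 _ _ {{ℕP.m*n≢0 _ _ {{suc k ℕP.!≢0}} {{suc k ℕP.!≢0}}}} {{r ℕP.!≢0}}
    ratio-next : d * + aperyBinomial (suc n) (suc k) ≡ e * (M * (N + K + + 2))
    ratio-next = trans (pos-*-≡ {D} {E = E} (ratio-[n+1,k+1] k r))
                       (cong (e *_) (ℤP.pos-* (n ℕ.+ k ℕ.+ 1) (n ℕ.+ k ℕ.+ 2)))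
    ratio-here : d * + aperyBinomial n (suc k) ≡ e * (M * R)
    ratio-here = trans (pos-*-≡ {D} {E = E} (ratio-[n,k+1] k r)) (cong (e *_) (ℤP.pos-* (n ℕ.+ k ℕ.+ 1) r))
    ratio-prev : d * + aperyBinomial (n ∸ 1) (suc k) ≡ e * (R * (R - 1ℤ))
    ratio-prev = trans (pos-*-≡ {D} {E = E} (ratio-[n-1,k+1] k r)) (cong (e *_) (pos-*-pred r))
    ratio-diag : d * + aperyBinomial n k ≡ e * ((K + 1ℤ) * (K + 1ℤ))
    ratio-diag = trans (pos-*-≡ {D} {E = E} (ratio-[n,k] k r))
                       (cong (e *_) (ℤP.pos-* (k ℕ.+ 1) (k ℕ.+ 1)))

  certificate-telescopes : ∀ n j → j < 2 ℕ.+ n →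
    apéryOp (λ m → + aperySummand m j) n ≡ certificate n (suc j) - certificate n j
  certificate-telescopes n zero    _                = initial (+ n)
    where
    initial : ∀ N → (N + 1ℤ) * (N + 1ℤ) * (N + 1ℤ) * 1ℤ
                    - (+ 2 * N + 1ℤ) * (+ 17 * N * N + + 17 * N + + 5) * 1ℤ
                    + N * N * N * 1ℤ
                    ≡ + 4 * (+ 2 * N + 1ℤ) * (0ℤ * (+ 2 * 0ℤ + 1ℤ) - (+ 2 * N + 1ℤ) * (+ 2 * N + 1ℤ)) * (1ℤ * 1ℤ)
                      - 0ℤ
    initial = solve-∀
  certificate-telescopes n (suc k) (s≤s (s≤s k≤n)) =
    subst (λ m → apéryOp (λ m′ → + aperySummand m′ (suc k)) m
                 ≡ certificate m (2 ℕ.+ k) - certificate m (suc k))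
          (ℕP.m+[n∸m]≡n k≤n) (certificate-step k (n ∸ k))

  apéryOp-apery≡0 : ∀ n → apéryOp (λ m → + apery m) n ≡ 0ℤ
  apéryOp-apery≡0 n = begin
    apéryOp (λ m → + apery m) n
      ≡⟨ apéryOp-cong n (λ m m≤1+n → apery≡sumℤ (s≤s m≤1+n)) ⟩
    apéryOp (λ m → sumℤ (2 ℕ.+ n) (λ j → + aperySummand m j)) n
      ≡⟨ apéryOp-sumℤ (2 ℕ.+ n) (λ m j → + aperySummand m j) n ⟩
    sumℤ (2 ℕ.+ n) (λ j → apéryOp (λ m → + aperySummand m j) n)
      ≡⟨ sumℤ-telescope {g = certificate n} (2 ℕ.+ n) refl (certificate-telescopes n) ⟩
    certificateWeight (+ n) (+ suc n) * (+ aperyBinomial n (suc n) * + aperyBinomial n (suc n))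
      ≡⟨ cong (λ c → certificateWeight (+ n) (+ suc n) * (+ c * + c)) (aperyBinomial-vanish {n} ℕP.≤-refl) ⟩
    certificateWeight (+ n) (+ suc n) * 0ℤ
      ≡⟨ ℤP.*-zeroʳ (certificateWeight (+ n) (+ suc n)) ⟩
    0ℤ ∎

  apéry-recurrence : ∀ n → (+ n + + 1) ^ 3 * + apery (suc n)
                           - (+ 2 * + n + + 1) * (+ 17 * (+ n) ^ 2 + + 17 * + n + + 5) * + apery n
                           + (+ n) ^ 3 * + apery (n ∸ 1) ≡ 0ℤ
  apéry-recurrence n = trans (apéryOp-powers (λ m → + apery m) n) (apéryOp-apery≡0 n)

module CanonicalMap {c ℓ} (F : Field c ℓ) where

  open Field F
  open import Data.Nat as ℕ using (ℕ; zero; suc; _∸_)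
  import Data.Nat.Properties as ℕP
  open import Data.Integer as ℤ using (ℤ; +_; -[1+_]; _⊖_)
  import Data.Integer.Properties as ℤP
  open import Data.Maybe using (Maybe; just; nothing)
  open import Relation.Nullary using (yes; no)
  import Relation.Binary.PropositionalEquality as ≡
  open import Algebra.Properties.Semiring.Mult semiring using (_×_; ×-homo-+)
  open import Algebra.Properties.Ring ring using (-‿distribʳ-*; -0#≈0#; -‿involutive)
  open import Algebra.Properties.AbelianGroup +-abelianGroup using (⁻¹-∙-comm)
  open import Algebra.Solver.Ring.AlmostCommutativeRing using (fromCommutativeRing; _-Raw-AlmostCommutative⟶_)
  import Algebra.Solver.Ring as RingSolver
  open import Relation.Binary.Reasoning.Setoid setoid
  open ApéryRecurrence using (apéry-recurrence)

  ιℕ≡×1# : ∀ n → ιℕ F n ≡.≡ n × 1#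
  ιℕ≡×1# zero    = ≡.refl
  ιℕ≡×1# (suc n) = ≡.cong (λ t → 1# + t) (ιℕ≡×1# n)

  ιℕ-+ : ∀ m n → ιℕ F (m ℕ.+ n) ≈ ιℕ F m + ιℕ F n
  ιℕ-+ m n rewrite ιℕ≡×1# (m ℕ.+ n) | ιℕ≡×1# m | ιℕ≡×1# n = ×-homo-+ 1# m n

  [o+a]-[o+b]≈a-b : ∀ o a b → (o + a) - (o + b) ≈ a - b
  [o+a]-[o+b]≈a-b o a b = begin
    (o + a) + - (o + b)        ≈⟨ +-cong (+-comm o a) (sym (⁻¹-∙-comm o b)) ⟩
    (a + o) + (- o + - b)      ≈⟨ +-assoc a o _ ⟩
    a + (o + (- o + - b))      ≈⟨ +-congˡ (sym (+-assoc o (- o) (- b))) ⟩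
    a + ((o + - o) + - b)      ≈⟨ +-congˡ (+-congʳ (-‿inverseʳ o)) ⟩
    a + (0# + - b)             ≈⟨ +-congˡ (+-identityˡ (- b)) ⟩
    a + - b                    ∎

  ιℤ-⊖ : ∀ m n → ιℤ F (m ⊖ n) ≈ ιℕ F m - ιℕ F n
  ιℤ-⊖ m       zero    = sym (trans (+-congˡ -0#≈0#) (+-identityʳ _))
  ιℤ-⊖ zero    (suc n) = sym (+-identityˡ _)
  ιℤ-⊖ (suc m) (suc n) = begin
    ιℤ F (suc m ⊖ suc n)          ≡⟨ ≡.cong (ιℤ F) (ℤP.[1+m]⊖[1+n]≡m⊖n m n) ⟩
    ιℤ F (m ⊖ n)                  ≈⟨ ιℤ-⊖ m n ⟩
    ιℕ F m - ιℕ F n               ≈⟨ sym ([o+a]-[o+b]≈a-b 1# (ιℕ F m) (ιℕ F n)) ⟩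
    (1# + ιℕ F m) - (1# + ιℕ F n) ∎

  ιℤ-neg : ∀ i → ιℤ F (ℤ.- i) ≈ - ιℤ F i
  ιℤ-neg -[1+ n ]  = sym (-‿involutive _)
  ιℤ-neg (+ zero)  = sym -0#≈0#
  ιℤ-neg (+ suc n) = refl

  ιℤ-+ : ∀ i j → ιℤ F (i ℤ.+ j) ≈ ιℤ F i + ιℤ F j
  ιℤ-+ (+ m)    (+ n)    = ιℕ-+ m n
  ιℤ-+ (+ m)    -[1+ n ] = ιℤ-⊖ m (suc n)
  ιℤ-+ -[1+ m ] (+ n)    = trans (ιℤ-⊖ n (suc m)) (+-comm _ _)
  ιℤ-+ -[1+ m ] -[1+ n ] = begin
    - ιℕ F (suc (suc (m ℕ.+ n)))       ≡⟨ ≡.cong (λ t → - ιℕ F (suc t)) (≡.sym (ℕP.+-suc m n)) ⟩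
    - ιℕ F (suc m ℕ.+ suc n)           ≈⟨ -‿cong (ιℕ-+ (suc m) (suc n)) ⟩
    - (ιℕ F (suc m) + ιℕ F (suc n))    ≈⟨ sym (⁻¹-∙-comm _ _) ⟩
    - ιℕ F (suc m) + - ιℕ F (suc n)    ∎

  ιℤ-- : ∀ i j → ιℤ F (i ℤ.- j) ≈ ιℤ F i - ιℤ F j
  ιℤ-- i j = trans (ιℤ-+ i (ℤ.- j)) (+-congˡ (ιℤ-neg j))

  ιℤ-*-+ : ∀ i n → ιℤ F (i ℤ.* + n) ≈ ιℤ F i * ιℕ F n
  ιℤ-*-+ i zero    = trans (reflexive (≡.cong (ιℤ F) (ℤP.*-zeroʳ i))) (sym (zeroʳ _))
  ιℤ-*-+ i (suc n) = begin
    ιℤ F (i ℤ.* + suc n)              ≡⟨ ≡.cong (ιℤ F) (ℤP.*-suc i (+ n)) ⟩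
    ιℤ F (i ℤ.+ i ℤ.* + n)            ≈⟨ ιℤ-+ i (i ℤ.* + n) ⟩
    ιℤ F i + ιℤ F (i ℤ.* + n)         ≈⟨ +-congˡ (ιℤ-*-+ i n) ⟩
    ιℤ F i + ιℤ F i * ιℕ F n          ≈⟨ +-congʳ (sym (*-identityʳ _)) ⟩
    ιℤ F i * 1# + ιℤ F i * ιℕ F n     ≈⟨ sym (distribˡ _ _ _) ⟩
    ιℤ F i * (1# + ιℕ F n)            ∎

  ιℤ-* : ∀ i j → ιℤ F (i ℤ.* j) ≈ ιℤ F i * ιℤ F j
  ιℤ-* i (+ n)    = ιℤ-*-+ i n
  ιℤ-* i -[1+ n ] = begin
    ιℤ F (i ℤ.* -[1+ n ])             ≡⟨ ≡.cong (ιℤ F) (≡.sym (ℤP.neg-distribʳ-* i (+ suc n))) ⟩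
    ιℤ F (ℤ.- (i ℤ.* + suc n))        ≈⟨ ιℤ-neg (i ℤ.* + suc n) ⟩
    - ιℤ F (i ℤ.* + suc n)            ≈⟨ -‿cong (ιℤ-*-+ i (suc n)) ⟩
    - (ιℤ F i * ιℕ F (suc n))         ≈⟨ -‿distribʳ-* (ιℤ F i) (ιℕ F (suc n)) ⟩
    ιℤ F i * - ιℕ F (suc n)           ∎

  ιℤ-homomorphism : ℤ.+-*-rawRing -Raw-AlmostCommutative⟶ fromCommutativeRing commutativeRing
  ιℤ-homomorphism = record
    { ⟦_⟧    = ιℤ F
    ; +-homo = ιℤ-+
    ; *-homo = ιℤ-*
    ; -‿homo = ιℤ-neg
    ; 0-homo = refl
    ; 1-homo = +-identityʳ 1#
    }

  private
    ιℤ-≟ : ∀ i j → Maybe (ιℤ F i ≈ ιℤ F j)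
    ιℤ-≟ i j with i ℤ.≟ j
    ... | yes ≡.refl = just refl
    ... | no _       = nothing

  open RingSolver ℤ.+-*-rawRing (fromCommutativeRing commutativeRing) ιℤ-homomorphism ιℤ-≟
    using (solve; _:+_; _:*_; _:-_; _:=_)

  sumF-telescope : ∀ {f g : ℕ → Carrier} → g 0 ≈ 0# → (∀ k → f k ≈ g (suc k) - g k) →
                   ∀ n → sumF F n f ≈ g n
  sumF-telescope g0≈0 step zero = sym g0≈0
  sumF-telescope {f} {g} g0≈0 step (suc n) = begin
    sumF F n f + f n          ≈⟨ +-cong (sumF-telescope {g = g} g0≈0 step n) (step n) ⟩
    g n + (g (suc n) - g n)   ≈⟨ solve 2 (λ a b → a :+ (b :- a) := b) refl (g n) (g (suc n)) ⟩
    g (suc n)                 ∎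

  lagrange-identity : ∀ a p q x₀ x₁ x₂ A₋ A₀ A₊ → a * A₊ - p * A₀ + q * A₋ ≈ 0# →
    (a * x₀ - p * x₁ + q * x₂) * A₀ ≈ a * (x₀ * A₀ - x₁ * A₊) - q * (x₁ * A₋ - x₂ * A₀)
  lagrange-identity a p q x₀ x₁ x₂ A₋ A₀ A₊ recurrence = begin
    (a * x₀ - p * x₁ + q * x₂) * A₀
      ≈⟨ solve 9 (λ a p q x₀ x₁ x₂ A₋ A₀ A₊ →
           (a :* x₀ :- p :* x₁ :+ q :* x₂) :* A₀
           := a :* (x₀ :* A₀ :- x₁ :* A₊) :- q :* (x₁ :* A₋ :- x₂ :* A₀)
              :+ x₁ :* (a :* A₊ :- p :* A₀ :+ q :* A₋))
           refl a p q x₀ x₁ x₂ A₋ A₀ A₊ ⟩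
    a * (x₀ * A₀ - x₁ * A₊) - q * (x₁ * A₋ - x₂ * A₀) + x₁ * (a * A₊ - p * A₀ + q * A₋)
      ≈⟨ +-congˡ (trans (*-congˡ recurrence) (zeroʳ x₁)) ⟩
    a * (x₀ * A₀ - x₁ * A₊) - q * (x₁ * A₋ - x₂ * A₀) + 0#
      ≈⟨ +-identityʳ _ ⟩
    a * (x₀ * A₀ - x₁ * A₊) - q * (x₁ * A₋ - x₂ * A₀) ∎

  ιℤ-combination : ∀ a x b y c z → ιℤ F (a ℤ.* x ℤ.- b ℤ.* y ℤ.+ c ℤ.* z)
                                   ≈ ιℤ F a * ιℤ F x - ιℤ F b * ιℤ F y + ιℤ F c * ιℤ F z
  ιℤ-combination a x b y c z = begin
    ιℤ F (a ℤ.* x ℤ.- b ℤ.* y ℤ.+ c ℤ.* z)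
      ≈⟨ ιℤ-+ (a ℤ.* x ℤ.- b ℤ.* y) (c ℤ.* z) ⟩
    ιℤ F (a ℤ.* x ℤ.- b ℤ.* y) + ιℤ F (c ℤ.* z)
      ≈⟨ +-cong (ιℤ-- (a ℤ.* x) (b ℤ.* y)) (ιℤ-* c z) ⟩
    ιℤ F (a ℤ.* x) - ιℤ F (b ℤ.* y) + ιℤ F c * ιℤ F z
      ≈⟨ +-congʳ (+-cong (ιℤ-* a x) (-‿cong (ιℤ-* b y))) ⟩
    ιℤ F a * ιℤ F x - ιℤ F b * ιℤ F y + ιℤ F c * ιℤ F z ∎

  ιℤ-apéry-recurrence : ∀ n →
    ιℤ F ((+ n ℤ.+ + 1) ℤ.^ 3) * ιℕ F (apery (suc n))
    - ιℤ F ((+ 2 ℤ.* + n ℤ.+ + 1) ℤ.* (+ 17 ℤ.* (+ n) ℤ.^ 2 ℤ.+ + 17 ℤ.* + n ℤ.+ + 5)) * ιℕ F (apery n)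
    + ιℤ F ((+ n) ℤ.^ 3) * ιℕ F (apery (n ∸ 1)) ≈ 0#
  ιℤ-apéry-recurrence n = trans (sym (ιℤ-combination
      ((+ n ℤ.+ + 1) ℤ.^ 3) (+ apery (suc n))
      ((+ 2 ℤ.* + n ℤ.+ + 1) ℤ.* (+ 17 ℤ.* (+ n) ℤ.^ 2 ℤ.+ + 17 ℤ.* + n ℤ.+ + 5)) (+ apery n)
      ((+ n) ℤ.^ 3) (+ apery (n ∸ 1))))
    (reflexive (≡.cong (ιℤ F) (apéry-recurrence n)))

lemma3p3 : ∀ {c ℓ} (F : Field c ℓ) → CharZero F →
  (x : Poly F) (n : ℕ) → 1 ≤ n →
  let open Field F
      X : ℤ → Carrier
      X m = eval F x (ιℤ F m)
      I : ℤ → Carrier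
      I = ιℤ F
      A : ℕ → Carrier
      A m = ιℕ F (apery m)
  in sumF F n (λ k →
       ((I ((+ k ℤ.+ + 1) ℤ.^ 3) * X (+ k))
         - (I ((+ 2 ℤ.* + k ℤ.+ + 1) ℤ.* (+ 17 ℤ.* (+ k) ℤ.^ 2 ℤ.+ + 17 ℤ.* + k ℤ.+ + 5)) * X (+ k ℤ.- + 1))
         + (I ((+ k) ℤ.^ 3) * X (+ k ℤ.- + 2))) * A k)
     ≈ I ((+ n) ℤ.^ 3) * ((X (+ n ℤ.- + 1) * A (n ℕ.∸ 1)) - (X (+ n ℤ.- + 2) * A n))
lemma3p3 F _ x n _ = sumF-telescope {g = g} (zeroˡ _) step n
  where
  open Field F
  open CanonicalMap F
  open import Relation.Binary.Reasoning.Setoid setoid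
  import Relation.Binary.PropositionalEquality as ≡
  import Data.Nat.Properties as ℕP
  import Data.Integer.Properties as ℤP

  X : ℤ → Carrier
  X m = eval F x (ιℤ F m)
  A : ℕ → Carrier
  A m = ιℕ F (apery m)
  a p q : ℕ → Carrier
  a k = ιℤ F ((+ k ℤ.+ + 1) ℤ.^ 3)
  p k = ιℤ F ((+ 2 ℤ.* + k ℤ.+ + 1) ℤ.* (+ 17 ℤ.* (+ k) ℤ.^ 2 ℤ.+ + 17 ℤ.* + k ℤ.+ + 5))
  q k = ιℤ F ((+ k) ℤ.^ 3)

  g : ℕ → Carrier
  g k = q k * (X (+ k ℤ.- + 1) * A (k ℕ.∸ 1) - X (+ k ℤ.- + 2) * A k)

  a≈q[1+k] : ∀ k → a k ≈ q (ℕ.suc k)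
  a≈q[1+k] k = reflexive (≡.cong (λ t → ιℤ F ((+ t) ℤ.^ 3)) (ℕP.+-comm k 1))

  X-shift : ∀ k → X (+ k ℤ.- + 1) ≈ X (+ ℕ.suc k ℤ.- + 2)
  X-shift k = reflexive (≡.cong X (≡.sym (ℤP.[1+m]⊖[1+n]≡m⊖n k 1)))

  step : ∀ k → (a k * X (+ k) - p k * X (+ k ℤ.- + 1) + q k * X (+ k ℤ.- + 2)) * A k ≈ g (ℕ.suc k) - g k
  step k = begin
    (a k * X (+ k) - p k * X (+ k ℤ.- + 1) + q k * X (+ k ℤ.- + 2)) * A k
      ≈⟨ lagrange-identity (a k) (p k) (q k) (X (+ k)) (X (+ k ℤ.- + 1)) (X (+ k ℤ.- + 2))
                           (A (k ℕ.∸ 1)) (A k) (A (ℕ.suc k)) (ιℤ-apéry-recurrence k) ⟩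
    a k * (X (+ k) * A k - X (+ k ℤ.- + 1) * A (ℕ.suc k)) - g k
      ≈⟨ +-congʳ (*-cong (a≈q[1+k] k) (+-congˡ (-‿cong (*-congʳ (X-shift k))))) ⟩
    g (ℕ.suc k) - g k ∎
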